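{- The greedy partition of length $1$ is the partition of $\mathbb{N}_+$ into singletons $\{m\}$ (so the greedy convolution of length 1 is the unitary convolution), and the greedy partition of length $2$ is the partition of $\mathbb{N}_+$ into the parts $\{m,2m\}$ where $m$ ranges over the positive integers of the form $4^k\ell$ with $k\ge 0$ and $\ell$ odd (so the greedy convolution of length 2 is the ternary convolution).
   Context: Fix a positive integer $d$. The greedy partition of length $d$ of $\mathbb{N}_+$ is built by processing $n=1,2,3,\dots$ in order. At each stage every existing part has the form $\{k,2k,\dots,mk\}$ with $1\le m\le d$. The integer $n$ is appended to the existing part $\{k,\dots,mk\}$ with $n=(m+1)k$ and $m+1\le d$, choosing the one with smallest $k$ if several exist; if no such part exists, $n$ starts a new part $\{n\}$. The greedy convolution of length $d$ is the homogeneous regular (Narkiewicz) convolution whose blocks are $\{0\}\cup s$ for the parts $s$. The unitary convolution corresponds to the partition into singletons; the ternary convolution to the partition into parts $\{m,2m\}$ with $m=4^k\ell$, $\ell$ odd. -}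

module Defs where

open import Data.Nat using (ℕ; zero; suc; _+_; _*_; _≤_; _≤ᵇ_; _≡ᵇ_; _⊓_)
open import Data.Bool using (Bool; true; false; _∧_; if_then_else_)
open import Data.Maybe using (Maybe; just; nothing)
open import Data.Product using (_×_; _,_; ∃)
open import Data.List using (List; []; _∷_; map; _++_; [_])
open import Data.List.Membership.Propositional using (_∈_)
open import Relation.Binary.PropositionalEquality using (_≡_)

-- A part {k, 2k, ..., mk} is encoded by the pair (k , m)  (k = base, m = length).
Part : Set
Part = ℕ × ℕ

multiplesUpTo : ℕ → ℕ → List ℕ
multiplesUpTo k zero    = []
multiplesUpTo k (suc m) = multiplesUpTo k m ++ [ suc m * k ]

elems : Part → List ℕ
elems (k , m) = multiplesUpTo k m

appendable : ℕ → ℕ → Part → Bool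
appendable d n (k , m) = ((suc m * k) ≡ᵇ n) ∧ (suc m ≤ᵇ d)

minOpt : Maybe ℕ → ℕ → Maybe ℕ
minOpt nothing  k = just k
minOpt (just j) k = just (j ⊓ k)

bestBase : ℕ → ℕ → List Part → Maybe ℕ
bestBase d n []             = nothing
bestBase d n (p ∷ ps) with appendable d n p | bestBase d n ps
... | true  | r = minOpt r (Data.Product.proj₁ p)
... | false | r = r

extend : ℕ → List Part → List Part
extend k []             = []
extend k ((j , m) ∷ ps) = if j ≡ᵇ k then (j , suc m) ∷ extend k ps
                                    else (j , m) ∷ extend k ps

step : ℕ → ℕ → List Part → List Part
step d n ps with bestBase d n ps
... | just k  = extend k ps
... | nothing = ps ++ [ (n , 1) ]

greedyState : ℕ → ℕ → List Part
greedyState d zero    = []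
greedyState d (suc n) = step d (suc n) (greedyState d n)

-- s is a part of the greedy partition of length d (of ℕ₊): s is (the list of
-- elements, in increasing order, of) a part which is present, unchanged, in the
-- state at every sufficiently late stage.
IsGreedyPart : ℕ → List ℕ → Set
IsGreedyPart d s = ∃ λ (p : Part) → (s ≡ elems p) × ∃ λ N → ∀ n → N ≤ n → p ∈ greedyState d n

-- Each stage of the greedy construction can be described in closed form, and the description is
-- preserved by one greedy step. For length 1 no part can ever grow, so every n opens the part {n}.
-- For length 2, every n ≥ 1 is either a base 4ᵏ ℓ (ℓ odd) or twice a base, never both. A base n
-- cannot be appended anywhere (it would have to be twice a base), so it opens {n}; n = 2c with c
-- a base is appendable only to the open part {c} (the parts {b, 2b} are full), which it closes.
-- So at stage n the parts are {b, 2b} for bases b with 2b ≤ n and {b} for bases b ≤ n < 2b, and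
-- the parts that eventually stay fixed are exactly the {b, 2b}.
module Submission where

open import Defs
open import Data.Nat using (ℕ; zero; suc; _+_; _*_; _^_; _%_; _≤_; _<_; s≤s; z≤n; _≡ᵇ_; _⊓_)
open import Data.Nat.Properties
open import Data.Nat.DivMod using (m*n%n≡0; [m+kn]%n≡m%n)
open import Data.Nat.Induction using (<-wellFounded)
open import Induction.WellFounded using (Acc; acc)
open import Data.Bool using (true; false; if_then_else_)
open import Data.Bool.Properties using (T-≡; ∧-zeroʳ; ∧-identityʳ)
open import Data.Maybe using (just; nothing)
open import Data.Product using (_×_; _,_; ∃; proj₁; map₁; map₂)
open import Data.Product.Function.NonDependent.Propositional using (_×-⇔_)
open import Data.Sum using (_⊎_; inj₁; inj₂)
open import Data.Sum.Function.Propositional using (_⊎-⇔_)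
open import Data.List using (List; []; _∷_; map; [_])
open import Data.List.Relation.Unary.Any using (here; there)
open import Data.List.Relation.Unary.Any.Properties using (singleton⁺; singleton⁻)
open import Data.List.Membership.Propositional using (_∈_)
open import Data.List.Membership.Propositional.Properties using (++-∈⇔; map-∈↔)
open import Function using (_∘_)
open import Function.Bundles using (_⇔_; mk⇔; Equivalence)
open import Function.Construct.Identity using (⇔-id)
open import Function.Construct.Symmetry using (⇔-sym)
open import Function.Construct.Composition using (_⇔-∘_)
open import Function.Properties.Inverse using (↔⇒⇔)
open import Relation.Nullary using (¬_; yes; no; contradiction)
open import Relation.Binary.PropositionalEquality hiding ([_])

open Equivalence using (to; from)

IsBase : ℕ → Set
IsBase b = ∃ λ k → ∃ λ ℓ → ℓ % 2 ≡ 1 × b ≡ 4 ^ k * ℓ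

IsDoubleBase : ℕ → Set
IsDoubleBase n = ∃ λ c → IsBase c × n ≡ 2 * c

1+n<2*[1+n] : ∀ n → suc n < 2 * suc n
1+n<2*[1+n] n = m<m+n (suc n) (s≤s z≤n)

odd⇒≢double : ∀ {ℓ} x → ℓ % 2 ≡ 1 → ℓ ≢ 2 * x
odd⇒≢double x odd refl
  with trans (sym (m*n%n≡0 x 2)) (trans (cong (_% 2) (*-comm x 2)) odd)
... | ()

4^[1+k]*ℓ≡2*[2*[4^k*ℓ]] : ∀ k ℓ → 4 ^ suc k * ℓ ≡ 2 * (2 * (4 ^ k * ℓ))
4^[1+k]*ℓ≡2*[2*[4^k*ℓ]] k ℓ = trans (*-assoc 4 (4 ^ k) ℓ) (*-assoc 2 2 (4 ^ k * ℓ))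

4^[1+k]*ℓ≡2*x⇒2*[4^k*ℓ]≡x : ∀ k ℓ {x} → 4 ^ suc k * ℓ ≡ 2 * x → 2 * (4 ^ k * ℓ) ≡ x
4^[1+k]*ℓ≡2*x⇒2*[4^k*ℓ]≡x k ℓ {x} eq =
  *-cancelˡ-≡ (2 * (4 ^ k * ℓ)) x 2 (trans (sym (4^[1+k]*ℓ≡2*[2*[4^k*ℓ]] k ℓ)) eq)

4^k*odd≢2*4^j*odd : ∀ k j {ℓ ℓ′} → ℓ % 2 ≡ 1 → ℓ′ % 2 ≡ 1 → 4 ^ k * ℓ ≢ 2 * (4 ^ j * ℓ′)
4^k*odd≢2*4^j*odd zero j {ℓ′ = ℓ′} odd odd′ eq =
  odd⇒≢double (4 ^ j * ℓ′) odd (trans (sym (*-identityˡ _)) eq)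
4^k*odd≢2*4^j*odd (suc k) zero {ℓ} {ℓ′} odd odd′ eq =
  odd⇒≢double (4 ^ k * ℓ) odd′
    (trans (sym (*-identityˡ ℓ′)) (sym (4^[1+k]*ℓ≡2*x⇒2*[4^k*ℓ]≡x k ℓ eq)))
4^k*odd≢2*4^j*odd (suc k) (suc j) {ℓ} {ℓ′} odd odd′ eq =
  4^k*odd≢2*4^j*odd k j odd odd′
    (*-cancelˡ-≡ (4 ^ k * ℓ) (2 * (4 ^ j * ℓ′)) 2
      (trans (4^[1+k]*ℓ≡2*x⇒2*[4^k*ℓ]≡x k ℓ eq) (4^[1+k]*ℓ≡2*[2*[4^k*ℓ]] j ℓ′)))

base⇒¬doubleBase : ∀ {n} → IsBase n → ¬ IsDoubleBase n
base⇒¬doubleBase (k , ℓ , odd , refl) (c , (j , ℓ′ , odd′ , refl) , eq) =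
  4^k*odd≢2*4^j*odd k j odd odd′ eq

¬base0 : ¬ IsBase 0
¬base0 base = base⇒¬doubleBase base (0 , base , refl)

even⊎odd : ∀ n → ∃ λ h → n ≡ 2 * h ⊎ n ≡ suc (2 * h)
even⊎odd zero = 0 , inj₁ refl
even⊎odd (suc n) with even⊎odd n
... | h , inj₁ refl = h , inj₂ refl
... | h , inj₂ refl = suc h , inj₁ (cong suc (sym (+-suc h (h + 0))))

[1+2*h]%2≡1 : ∀ h → suc (2 * h) % 2 ≡ 1
[1+2*h]%2≡1 h = trans (cong (λ x → suc x % 2) (*-comm 2 h)) ([m+kn]%n≡m%n 1 h 2)

base⊎doubleBase : ∀ n → 1 ≤ n → IsBase n ⊎ IsDoubleBase n
base⊎doubleBase n = go n (<-wellFounded n)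
  where
  go : ∀ n → Acc _<_ n → 1 ≤ n → IsBase n ⊎ IsDoubleBase n
  go n (acc rec) 1≤n with even⊎odd n
  ... | h , inj₂ refl = inj₁ (0 , suc (2 * h) , [1+2*h]%2≡1 h , sym (*-identityˡ _))
  ... | zero , inj₁ refl with () ← 1≤n
  ... | suc h , inj₁ refl with go (suc h) (rec (1+n<2*[1+n] h)) (s≤s z≤n)
  ...   | inj₁ base = inj₂ (suc h , base , refl)
  ...   | inj₂ (c , (k , ℓ , odd , refl) , eq) =
          inj₁ (suc k , ℓ , odd , trans (cong (2 *_) eq) (sym (4^[1+k]*ℓ≡2*[2*[4^k*ℓ]] k ℓ)))

Enumerates : (Part → Set) → List Part → Set
Enumerates P ps = ∀ p → p ∈ ps ⇔ P p

bestBase-none : ∀ {d n} ps → (∀ {p} → p ∈ ps → appendable d n p ≢ true) →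
                bestBase d n ps ≡ nothing
bestBase-none [] _ = refl
bestBase-none {d} {n} (p ∷ ps) none with appendable d n p | none (here refl)
... | true | ¬app = contradiction refl ¬app
... | false | _ = bestBase-none ps (none ∘ there)

bestBase-sole : ∀ {d n k} ps → (∀ {p} → p ∈ ps → appendable d n p ≡ true → proj₁ p ≡ k) →
                bestBase d n ps ≡ nothing ⊎ bestBase d n ps ≡ just k
bestBase-sole [] _ = inj₁ refl
bestBase-sole {d} {n} {k} (p ∷ ps) sole
  with appendable d n p in app | bestBase d n ps | bestBase-sole {d} {n} {k} ps (sole ∘ there)
... | false | _ | rest = rest
... | true | _ | inj₁ refl = inj₂ (cong just (sole (here refl) app))
... | true | _ | inj₂ refl =
  inj₂ (cong just (trans (cong (k ⊓_) (sole (here refl) app)) (⊓-idem k)))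

bestBase≡nothing⇒¬appendable : ∀ {d n p} ps → bestBase d n ps ≡ nothing → p ∈ ps →
                               appendable d n p ≡ false
bestBase≡nothing⇒¬appendable {d} {n} (q ∷ ps) none p∈
  with appendable d n q in app | bestBase d n ps in rest | p∈
... | false | _ | here refl = app
... | false | _ | there p∈ps = bestBase≡nothing⇒¬appendable ps (trans rest none) p∈ps
... | true | nothing | _ with () ← none
... | true | just _ | _ with () ← none

bestBase-unique : ∀ {d n k q} ps → (∀ {p} → p ∈ ps → appendable d n p ≡ true → proj₁ p ≡ k) →
                  q ∈ ps → appendable d n q ≡ true → bestBase d n ps ≡ just k
bestBase-unique ps sole q∈ app with bestBase-sole ps sole
... | inj₂ best = best
... | inj₁ none with () ← trans (sym app) (bestBase≡nothing⇒¬appendable ps none q∈)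

bump : ℕ → Part → Part
bump k (j , m) = if j ≡ᵇ k then (j , suc m) else (j , m)

bump-self : ∀ k m → bump k (k , m) ≡ (k , suc m)
bump-self k m with k ≡ᵇ k in e
... | true = refl
... | false with () ← trans (sym e) (to T-≡ (≡⇒≡ᵇ k k refl))

bump-other : ∀ {k j} m → j ≢ k → bump k (j , m) ≡ (j , m)
bump-other {k} {j} m j≢k with j ≡ᵇ k in e
... | true = contradiction (≡ᵇ⇒≡ j k (from T-≡ e)) j≢k
... | false = refl

extend≡map-bump : ∀ k ps → extend k ps ≡ map (bump k) ps
extend≡map-bump k [] = refl
extend≡map-bump k ((j , m) ∷ ps) with j ≡ᵇ k
... | true = cong ((j , suc m) ∷_) (extend≡map-bump k ps)
... | false = cong ((j , m) ∷_) (extend≡map-bump k ps)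

∈-step-fresh : ∀ {d n p} ps → bestBase d n ps ≡ nothing →
               p ∈ step d n ps ⇔ (p ∈ ps ⊎ p ≡ (n , 1))
∈-step-fresh ps none rewrite none = (⇔-id _ ⊎-⇔ mk⇔ singleton⁻ singleton⁺) ⇔-∘ ++-∈⇔

∈-step-extend : ∀ {d n k p} ps → bestBase d n ps ≡ just k →
                p ∈ step d n ps ⇔ ∃ λ q → q ∈ ps × p ≡ bump k q
∈-step-extend {k = k} ps best rewrite best | extend≡map-bump k ps =
  ⇔-sym (↔⇒⇔ (map-∈↔ (bump k)))

enumerates-step-fresh : ∀ {d n P Q} ps → bestBase d n ps ≡ nothing → Enumerates P ps →
                        (∀ p → Q p ⇔ (P p ⊎ p ≡ (n , 1))) → Enumerates Q (step d n ps)
enumerates-step-fresh ps none enum Q⇔ p =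
  ⇔-sym (Q⇔ p) ⇔-∘ ((enum p ⊎-⇔ ⇔-id _) ⇔-∘ ∈-step-fresh ps none)

enumerates-step-extend : ∀ {d n k P Q} ps → bestBase d n ps ≡ just k → Enumerates P ps →
                         (∀ p → Q p ⇔ ∃ λ q → P q × p ≡ bump k q) → Enumerates Q (step d n ps)
enumerates-step-extend {k = k} {P} ps best enum Q⇔ p =
  ⇔-sym (Q⇔ p) ⇔-∘ (members⇔ ⇔-∘ ∈-step-extend ps best)
  where
  members⇔ : (∃ λ q → q ∈ ps × p ≡ bump k q) ⇔ (∃ λ q → P q × p ≡ bump k q)
  members⇔ = mk⇔ (map₂ λ {q} → map₁ (to (enum q))) (map₂ λ {q} → map₁ (from (enum q)))

Stage₁ : ℕ → Part → Set
Stage₁ n (b , m) = 1 ≤ b × b ≤ n × m ≡ 1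

stage₁-suc : ∀ n p → Stage₁ (suc n) p ⇔ (Stage₁ n p ⊎ p ≡ (suc n , 1))
stage₁-suc n (b , m) = mk⇔ forth back
  where
  forth : Stage₁ (suc n) (b , m) → Stage₁ n (b , m) ⊎ (b , m) ≡ (suc n , 1)
  forth (1≤b , b≤1+n , refl) with m≤n⇒m<n∨m≡n b≤1+n
  ... | inj₁ b<1+n = inj₁ (1≤b , m<1+n⇒m≤n b<1+n , refl)
  ... | inj₂ refl = inj₂ refl
  back : Stage₁ n (b , m) ⊎ (b , m) ≡ (suc n , 1) → Stage₁ (suc n) (b , m)
  back (inj₁ (1≤b , b≤n , m≡1)) = 1≤b , m≤n⇒m≤1+n b≤n , m≡1
  back (inj₂ refl) = s≤s z≤n , ≤-refl , refl

greedyState-Stage₁ : ∀ n → Enumerates (Stage₁ n) (greedyState 1 n)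
greedyState-Stage₁ zero (b , m) = mk⇔ (λ ()) λ (1≤b , b≤0 , _) → contradiction (≤-trans 1≤b b≤0) λ ()
greedyState-Stage₁ (suc n) =
  enumerates-step-fresh ps (bestBase-none ps singletonsFull) (greedyState-Stage₁ n) (stage₁-suc n)
  where
  ps = greedyState 1 n
  singletonsFull : ∀ {p} → p ∈ ps → appendable 1 (suc n) p ≢ true
  singletonsFull {b , m} p∈ app with to (greedyState-Stage₁ n (b , m)) p∈
  ... | _ , _ , refl with () ← trans (sym (∧-zeroʳ _)) app

Stage₂ : ℕ → Part → Set
Stage₂ n (b , m) = IsBase b × b ≤ n × (2 * b ≤ n × m ≡ 2 ⊎ n < 2 * b × m ≡ 1)

stage₂-stable : ∀ {n b m} → b ≢ suc n → 2 * b ≢ suc n →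
                Stage₂ n (b , m) ⇔ Stage₂ (suc n) (b , m)
stage₂-stable b≢ 2b≢ =
  ⇔-id _ ×-⇔ (≤-stable b≢ ×-⇔ ((≤-stable 2b≢ ×-⇔ ⇔-id _) ⊎-⇔ (<-stable 2b≢ ×-⇔ ⇔-id _)))
  where
  ≤-stable : ∀ {a n} → a ≢ suc n → a ≤ n ⇔ a ≤ suc n
  ≤-stable a≢ = mk⇔ m≤n⇒m≤1+n (λ a≤1+n → m<1+n⇒m≤n (≤∧≢⇒< a≤1+n a≢))
  <-stable : ∀ {a n} → a ≢ suc n → n < a ⇔ suc n < a
  <-stable a≢ = mk⇔ (λ n<a → ≤∧≢⇒< n<a (a≢ ∘ sym)) (<-trans (n<1+n _))

stage₂-half : ∀ {n c} → IsBase c → suc n ≡ 2 * c → Stage₂ n (c , 1)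
stage₂-half {c = zero} _ ()
stage₂-half {c = suc c} base eq =
  base , m<1+n⇒m≤n (subst (suc c <_) (sym eq) (1+n<2*[1+n] c)) , inj₂ (≤-reflexive eq , refl)

stage₂-appendable : ∀ {n b m} → Stage₂ n (b , m) → appendable 2 (suc n) (b , m) ≡ true →
                    2 * b ≡ suc n
stage₂-appendable {n} {b} (_ , _ , inj₁ (_ , refl)) app
  with () ← trans (sym (∧-zeroʳ (3 * b ≡ᵇ suc n))) app
stage₂-appendable {n} {b} (_ , _ , inj₂ (_ , refl)) app =
  ≡ᵇ⇒≡ (2 * b) (suc n) (from T-≡ (trans (sym (∧-identityʳ _)) app))

stage₂-fresh : ∀ {n} → IsBase (suc n) →
               ∀ p → Stage₂ (suc n) p ⇔ (Stage₂ n p ⊎ p ≡ (suc n , 1))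
stage₂-fresh {n} base (b , m) = mk⇔ forth back
  where
  2b≢ : IsBase b → 2 * b ≢ suc n
  2b≢ b-base eq = base⇒¬doubleBase base (b , b-base , sym eq)
  forth : Stage₂ (suc n) (b , m) → Stage₂ n (b , m) ⊎ (b , m) ≡ (suc n , 1)
  forth st@(b-base , b≤1+n , len) with m≤n⇒m<n∨m≡n b≤1+n | len
  ... | inj₁ b<1+n | _ = inj₁ (from (stage₂-stable (<⇒≢ b<1+n) (2b≢ b-base)) st)
  ... | inj₂ refl | inj₁ (2b≤b , _) = contradiction 2b≤b (<⇒≱ (1+n<2*[1+n] n))
  ... | inj₂ refl | inj₂ (_ , refl) = inj₂ refl
  back : Stage₂ n (b , m) ⊎ (b , m) ≡ (suc n , 1) → Stage₂ (suc n) (b , m)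
  back (inj₁ st@(b-base , b≤n , _)) = to (stage₂-stable (<⇒≢ (s≤s b≤n)) (2b≢ b-base)) st
  back (inj₂ refl) = base , ≤-refl , inj₂ (1+n<2*[1+n] n , refl)

stage₂-extend : ∀ {n c} → IsBase c → suc n ≡ 2 * c →
                ∀ p → Stage₂ (suc n) p ⇔ ∃ λ q → Stage₂ n q × p ≡ bump c q
stage₂-extend {n} {c} c-base eq (b , m) = mk⇔ forth back
  where
  stable : ∀ {b m} → IsBase b → b ≢ c → Stage₂ n (b , m) ⇔ Stage₂ (suc n) (b , m)
  stable {b} b-base b≢c = stage₂-stable
    (λ b≡1+n → base⇒¬doubleBase (subst IsBase b≡1+n b-base) (c , c-base , eq))
    (λ 2b≡1+n → b≢c (*-cancelˡ-≡ b c 2 (trans 2b≡1+n eq)))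
  forth : Stage₂ (suc n) (b , m) → ∃ λ q → Stage₂ n q × (b , m) ≡ bump c q
  forth st@(b-base , _ , len) with b ≟ c | len
  ... | yes refl | inj₁ (_ , refl) = (c , 1) , stage₂-half c-base eq , sym (bump-self c 1)
  ... | yes refl | inj₂ (1+n<2c , _) = contradiction eq (<⇒≢ 1+n<2c)
  ... | no b≢c | _ = (b , m) , from (stable b-base b≢c) st , sym (bump-other m b≢c)
  back : (∃ λ q → Stage₂ n q × (b , m) ≡ bump c q) → Stage₂ (suc n) (b , m)
  back ((b′ , m′) , st@(b′-base , b′≤n , len) , refl) with b′ ≟ c | len
  ... | yes refl | inj₁ (2c≤n , _) = contradiction (subst (_≤ n) (sym eq) 2c≤n) 1+n≰n
  ... | yes refl | inj₂ (_ , refl) rewrite bump-self c 1 =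
        c-base , m≤n⇒m≤1+n b′≤n , inj₁ (≤-reflexive (sym eq) , refl)
  ... | no b′≢c | _ rewrite bump-other m′ b′≢c = to (stable b′-base b′≢c) st

greedyState-Stage₂ : ∀ n → Enumerates (Stage₂ n) (greedyState 2 n)
greedyState-Stage₂ zero (b , m) = mk⇔ (λ ()) λ where
  (b-base , z≤n , _) → contradiction b-base ¬base0
greedyState-Stage₂ (suc n) with base⊎doubleBase (suc n) (s≤s z≤n)
... | inj₁ base =
  enumerates-step-fresh ps (bestBase-none ps noneAppendable) (greedyState-Stage₂ n) (stage₂-fresh base)
  where
  ps = greedyState 2 n
  noneAppendable : ∀ {p} → p ∈ ps → appendable 2 (suc n) p ≢ true
  noneAppendable {p} p∈ app = base⇒¬doubleBase base (_ , proj₁ st , sym (stage₂-appendable st app))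
    where st = to (greedyState-Stage₂ n p) p∈
... | inj₂ (c , c-base , eq) =
  enumerates-step-extend ps (bestBase-unique ps onlyHalf c∈ c-appendable)
    (greedyState-Stage₂ n) (stage₂-extend c-base eq)
  where
  ps = greedyState 2 n
  onlyHalf : ∀ {p} → p ∈ ps → appendable 2 (suc n) p ≡ true → proj₁ p ≡ c
  onlyHalf {b , m} p∈ app =
    *-cancelˡ-≡ b c 2 (trans (stage₂-appendable (to (greedyState-Stage₂ n (b , m)) p∈) app) eq)
  c∈ : (c , 1) ∈ ps
  c∈ = from (greedyState-Stage₂ n (c , 1)) (stage₂-half c-base eq)
  c-appendable : appendable 2 (suc n) (c , 1) ≡ true
  c-appendable = trans (∧-identityʳ _) (to T-≡ (≡⇒≡ᵇ (2 * c) (suc n) (sym eq)))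

greedyParts₁ : ∀ (s : List ℕ) → IsGreedyPart 1 s ⇔ (∃ λ m → (1 ≤ m) × (s ≡ m ∷ []))
greedyParts₁ s = mk⇔ forth back
  where
  forth : IsGreedyPart 1 s → ∃ λ m → (1 ≤ m) × (s ≡ m ∷ [])
  forth ((b , m) , refl , N , eventually)
    with to (greedyState-Stage₁ N (b , m)) (eventually N ≤-refl)
  ... | 1≤b , _ , refl = b , 1≤b , cong [_] (*-identityˡ b)
  back : (∃ λ m → (1 ≤ m) × (s ≡ m ∷ [])) → IsGreedyPart 1 s
  back (b , 1≤b , refl) =
    (b , 1) , cong [_] (sym (*-identityˡ b)) , b ,
    λ n b≤n → from (greedyState-Stage₁ n (b , 1)) (1≤b , b≤n , refl)

greedyParts₂ : ∀ (s : List ℕ) → IsGreedyPart 2 s ⇔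
               (∃ λ k → ∃ λ ℓ → (ℓ % 2 ≡ 1) × (s ≡ (4 ^ k * ℓ) ∷ (2 * (4 ^ k * ℓ)) ∷ []))
greedyParts₂ s = mk⇔ forth back
  where
  BasePair : Set
  BasePair = ∃ λ k → ∃ λ ℓ → (ℓ % 2 ≡ 1) × (s ≡ (4 ^ k * ℓ) ∷ (2 * (4 ^ k * ℓ)) ∷ [])
  forth : IsGreedyPart 2 s → BasePair
  forth ((b , m) , refl , N , eventually)
    with to (greedyState-Stage₂ (N + 2 * b) (b , m)) (eventually _ (m≤m+n N _))
  ... | _ , _ , inj₂ (N+2b<2b , _) = contradiction N+2b<2b (≤⇒≯ (m≤n+m (2 * b) N))
  ... | (k , ℓ , odd , refl) , _ , inj₁ (_ , refl) =
        k , ℓ , odd , cong (λ x → x ∷ 2 * (4 ^ k * ℓ) ∷ []) (*-identityˡ _)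
  back : BasePair → IsGreedyPart 2 s
  back (k , ℓ , odd , refl) =
    (b , 2) , cong (λ x → x ∷ 2 * b ∷ []) (sym (*-identityˡ b)) , 2 * b ,
    λ n 2b≤n → from (greedyState-Stage₂ n (b , 2))
                  ((k , ℓ , odd , refl) , ≤-trans (m≤m+n b _) 2b≤n , inj₁ (2b≤n , refl))
    where b = 4 ^ k * ℓ

mainTheorem4 : (∀ (s : List ℕ) → IsGreedyPart 1 s ⇔ (∃ λ m → (1 ≤ m) × (s ≡ m ∷ [])))
    × (∀ (s : List ℕ) → IsGreedyPart 2 s ⇔
    (∃ λ k → ∃ λ ℓ → (ℓ % 2 ≡ 1) × (s ≡ (4 ^ k * ℓ) ∷ (2 * (4 ^ k * ℓ)) ∷ [])))
mainTheorem4 = greedyParts₁ , greedyParts₂
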